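{- Let $G$ be a graph containing two cherries $(u_1,a,u_2)$ and $(u_3,b,u_4)$ with $a\neq b$, and an isometric path $P$ of $G$ between their middle vertices $a$ and $b$. Let $H$ be the subgraph formed by the two cherries and $P$, and suppose that every vertex of $G$ not in $H$ has all its neighbours in $H$ among $\{a,b\}$. Then $G$ has an IP-partition of minimum cardinality containing the two cherries $(u_1,a,u_2)$ and $(u_3,b,u_4)$ as well as the path formed by the internal vertices of $P$ (i.e., $P$ with $a$ and $b$ removed).
   Context: All graphs are finite, simple and undirected. A cherry is an induced path on three vertices whose two endpoints have degree $1$ in $G$; its middle vertex is the vertex of degree $2$ in the path. A path is isometric if it is a shortest path in $G$ between its endpoints. An IP-partition of $G$ is a partition of $V(G)$ into vertex sets of isometric paths of $G$; its cardinality is the number of paths. -}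

module Defs where

open import Data.Nat using (ℕ; _≤_)
open import Data.Fin using (Fin)
open import Data.Bool using (Bool; true; false; T)
open import Data.List using (List; []; _∷_; length; filterᵇ; allFin; concat; reverse)
open import Data.List.Relation.Unary.Linked using (Linked)
open import Data.List.Relation.Unary.All using (All)
open import Data.List.Relation.Unary.Unique.Propositional using (Unique)
open import Data.List.Membership.Propositional using (_∈_)
open import Data.List.Relation.Binary.Permutation.Propositional using (_↭_)
open import Data.Product using (Σ; ∃; _×_)
open import Data.Sum using (_⊎_)
open import Data.Empty using (⊥)
open import Relation.Binary.PropositionalEquality using (_≡_; _≢_)

record Graph (n : ℕ) : Set where
  field
    adj    : Fin n → Fin n → Bool
    sym    : ∀ x y → adj x y ≡ adj y x
    irrefl : ∀ x → adj x x ≡ false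
open Graph public

module _ {n : ℕ} (G : Graph n) where

  Adj : Fin n → Fin n → Set
  Adj x y = T (adj G x y)

  degree : Fin n → ℕ
  degree x = length (filterᵇ (adj G x) (allFin n))

  Cherry : Fin n → Fin n → Fin n → Set
  Cherry x m y = Adj x m × Adj m y × x ≢ y × (Adj x y → ⊥)
                 × degree x ≡ 1 × degree y ≡ 1

endpoint : ∀ {A : Set} → A → List A → A
endpoint x []      = x
endpoint x (y ∷ w) = endpoint y w

dropLast : ∀ {A : Set} → List A → List A
dropLast []          = []
dropLast (x ∷ [])    = []
dropLast (x ∷ y ∷ w) = x ∷ dropLast (y ∷ w)

internal : ∀ {A : Set} → List A → List A
internal []      = []
internal (x ∷ w) = dropLast w

module _ {n : ℕ} (G : Graph n) where

  -- a walk starting at x, listed as x ∷ w (length = length w edges)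
  Walk : Fin n → List (Fin n) → Set
  Walk x w = Linked (Adj G) (x ∷ w)

  IsIsoPath : List (Fin n) → Set
  IsIsoPath []      = ⊥
  IsIsoPath (x ∷ w) = Unique (x ∷ w) × Walk x w
    × (∀ w′ → Walk x w′ → endpoint x w′ ≡ endpoint x w → length w ≤ length w′)

  IsoPathBetween : Fin n → Fin n → List (Fin n) → Set
  IsoPathBetween a b P = ∃ λ w → P ≡ a ∷ w × endpoint a w ≡ b × IsIsoPath P

  IPPartition : List (List (Fin n)) → Set
  IPPartition ps = All IsIsoPath ps × concat ps ↭ allFin n

  MinIPPartition : List (List (Fin n)) → Set
  MinIPPartition ps = IPPartition ps
    × (∀ qs → IPPartition qs → length ps ≤ length qs)

_∈ᵖ_ : ∀ {n} → List (Fin n) → List (List (Fin n)) → Set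
p ∈ᵖ ps = p ∈ ps ⊎ reverse p ∈ ps

{-# OPTIONS --safe #-}
-- Sort the vertices into hubs (a, b), pendants (the four cherry leaves), inner vertices
-- (the internal vertices of P) and outer vertices (those outside H).  Pendants are adjacent
-- only to hubs, and by hypothesis no edge joins an inner and an outer vertex.  Hence along
-- any path the hub-free stretches are a single pendant, a run of inner vertices or a run of
-- outer vertices, and a path meeting h hubs has at most h + 1 of them.  Summed over a
-- minimum IP-partition Q this gives
--   (number of maximal outer runs) + 4 + [P has internal vertices] ≤ |Q| + 2.
-- Subpaths of isometric paths are isometric, so the two cherries, the internal path of P
-- and the maximal outer runs of the paths of Q form an IP-partition that is no larger
-- than Q, hence minimum.
module Submission where

open import Defs hiding (sym)
open import Data.Nat using (ℕ; zero; suc; _+_; _≤_; _<_; z≤n; s≤s; _≤?_)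
open import Data.Nat.Properties
  using (≤-refl; ≤-reflexive; ≤-trans; ≤-pred; <⇒≤; ≰⇒>; n≤1+n; m≤n⇒m≤1+n; m≤m+n; m≤n+m;
         +-suc; +-mono-≤; +-monoʳ-≤; +-monoˡ-≤; +-cancelʳ-≤; module ≤-Reasoning)
open import Data.Nat.ListAction using (sum)
open import Data.Nat.Tactic.RingSolver using (solve-∀)
open import Data.Bool using (true; false; T; T?)
open import Data.Fin using (Fin; _≟_)
import Data.Fin.Properties as Fin
open import Data.List
  using (List; []; _∷_; _++_; [_]; length; map; concat; filter; allFin; cartesianProductWith)
open import Data.List.Properties
  using (length-++; length-map; length-tabulate; length-++-≤ˡ; length-++-≤ʳ; map-++; filter-++; filter-some;
         concat-++; concat-map-[_])
open import Data.List.Extrema.Nat using (argmin; argmin-all; f[argmin]≤f[xs])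
open import Data.List.Relation.Unary.All as All using (All; []; _∷_; all?)
import Data.List.Relation.Unary.All.Properties as Allₚ
open import Data.List.Relation.Unary.Any as Any using (Any; here; there)
import Data.List.Relation.Unary.Any.Properties as Anyₚ
open import Data.List.Relation.Unary.AllPairs using ([]; _∷_)
open import Data.List.Relation.Unary.Linked as Linked using (Linked; []; [-]; _∷_; linked?)
import Data.List.Relation.Unary.Linked.Properties as Linkedₚ
open import Data.List.Relation.Unary.Unique.Propositional using (Unique)
import Data.List.Relation.Unary.Unique.Propositional.Properties as Uniqueₚ
open import Data.List.Relation.Unary.Unique.DecPropositional using (unique?)
open import Data.List.Relation.Binary.Disjoint.Propositional using (Disjoint)
import Data.List.Relation.Binary.Prefix.Heterogeneous as Prefix
open import Data.List.Relation.Binary.Prefix.Heterogeneous using (Prefix; []; _∷_)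
open import Data.List.Relation.Binary.Infix.Heterogeneous using (Infix; here; there)
open import Data.List.Relation.Binary.Pointwise using (Pointwise-≡⇒≡)
open import Data.List.Relation.Binary.Permutation.Propositional
  using (_↭_; ↭-refl; ↭-prep; ↭-swap; ↭-trans; ↭-sym; ↭-reflexive; ↭⇒↭ₛ)
open import Data.List.Relation.Binary.Permutation.Propositional.Properties using (↭-length; ∈-resp-↭; shift)
import Data.List.Relation.Binary.Permutation.Setoid.Properties as Permₛ
open import Data.List.Relation.Binary.BagAndSetEquality using (∼bag⇒↭)
open import Data.List.Membership.Propositional using (_∈_; _∉_)
open import Data.List.Membership.Propositional.Properties
  using (∈-filter⁺; ∈-filter⁻; ∈-allFin; ∈-++⁺ˡ; ∈-++⁺ʳ; ∈-++⁻; ∈-concat⁻′; ∈-cartesianProductWith⁺)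
open import Data.List.Membership.Propositional.Properties.WithK using (unique∧set⇒bag)
open import Data.List.Membership.DecPropositional using (_∈?_)
open import Data.Product using (Σ; _×_; _,_; proj₁; proj₂; ∃; ∃₂; uncurry)
import Data.Product as Product
open import Data.Sum as Sum using (_⊎_; inj₁; inj₂)
open import Function using (_∘_)
open import Function.Bundles using (_⇔_; mk⇔; Equivalence)
open import Relation.Nullary using (Dec; yes; no; ¬_; does; contradiction; _×-dec_; _→-dec_)
open import Relation.Nullary.Decidable using (map′)
import Relation.Nullary.Decidable as Dec
open import Relation.Unary using (Pred; Decidable)
open import Relation.Binary.Core using (Rel)
open import Relation.Binary.Definitions using (DecidableEquality)
open import Relation.Binary.PropositionalEquality
  using (_≡_; _≢_; refl; sym; trans; cong; cong₂; subst; subst₂; setoid; module ≡-Reasoning)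

-- Maximal runs

module _ {a} {A : Set a} where

  infixr 5 _∷?_
  _∷?_ : List A → List (List A) → List (List A)
  []       ∷? xss = xss
  (x ∷ xs) ∷? xss = (x ∷ xs) ∷ xss

  concat-∷? : ∀ xs xss → concat (xs ∷? xss) ≡ xs ++ concat xss
  concat-∷? []       xss = refl
  concat-∷? (x ∷ xs) xss = refl

  length-∷? : ∀ xs xss → length (xs ∷? xss) ≡ length (xs ∷? []) + length xss
  length-∷? []       xss = refl
  length-∷? (x ∷ xs) xss = refl

  length-∷?-≤ : ∀ {m} xs → (∀ {y ys} → xs ≡ y ∷ ys → 1 ≤ m) → length (xs ∷? []) ≤ m
  length-∷?-≤ []       _        = z≤n
  length-∷?-≤ (x ∷ xs) nonempty = nonempty refl

  ∈-∷? : ∀ {xs} xss → xs ≢ [] → xs ∈ xs ∷? xss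
  ∈-∷? {[]}    xss xs≢[] = contradiction refl xs≢[]
  ∈-∷? {_ ∷ _} xss _     = here refl

  All-∷?⁺ : ∀ {q} {Q : Pred (List A) q} {xs xss} →
            (∀ {y ys} → xs ≡ y ∷ ys → Q (y ∷ ys)) → All Q xss → All Q (xs ∷? xss)
  All-∷?⁺ {xs = []}    _  qs = qs
  All-∷?⁺ {xs = _ ∷ _} qx qs = qx refl ∷ qs

  module _ {p} {P : Pred A p} (P? : Decidable P) where

    -- the leading run of P-elements, and the maximal runs after it
    spanRuns : List A → List A × List (List A)
    spanRuns []       = [] , []
    spanRuns (x ∷ xs) with does (P? x)
    ... | true  = Product.map₁ (x ∷_) (spanRuns xs)
    ... | false = [] , uncurry _∷?_ (spanRuns xs)

    runs : List A → List (List A)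
    runs xs = uncurry _∷?_ (spanRuns xs)

    concat-runs : ∀ xs → concat (runs xs) ≡ filter P? xs
    concat-runs xs = trans (concat-∷? (proj₁ (spanRuns xs)) _) (concat-spanRuns xs)
      where
      concat-spanRuns : ∀ xs → proj₁ (spanRuns xs) ++ concat (proj₂ (spanRuns xs)) ≡ filter P? xs
      concat-spanRuns []       = refl
      concat-spanRuns (x ∷ xs) with does (P? x)
      ... | true  = cong (x ∷_) (concat-spanRuns xs)
      ... | false = trans (concat-∷? (proj₁ (spanRuns xs)) _) (concat-spanRuns xs)

    runs-nonempty : ∀ {xs} → Any P xs → 0 < length (runs xs)
    runs-nonempty {xs} any with runs xs | concat-runs xs
    ... | []    | []≡filter =
      contradiction (subst (λ ys → 0 < length ys) (sym []≡filter) (filter-some P? any)) λ ()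
    ... | _ ∷ _ | _         = s≤s z≤n

    runs-all : ∀ {q} {Q : Pred (List A) q} xs →
               (∀ {y ys} → Infix _≡_ (y ∷ ys) xs → Q (y ∷ ys)) → All Q (runs xs)
    runs-all {Q = Q} xs infix⇒Q =
      All-∷?⁺ (λ lead≡ → infix⇒Q (here (subst (λ l → Prefix _≡_ l xs) lead≡ (lead-prefix xs))))
              (rest-all xs infix⇒Q)
      where
      lead-prefix : ∀ xs → Prefix _≡_ (proj₁ (spanRuns xs)) xs
      lead-prefix []       = []
      lead-prefix (x ∷ xs) with does (P? x)
      ... | true  = refl ∷ lead-prefix xs
      ... | false = []
      rest-all : ∀ xs → (∀ {y ys} → Infix _≡_ (y ∷ ys) xs → Q (y ∷ ys)) →
                 All Q (proj₂ (spanRuns xs))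
      rest-all []       _        = []
      rest-all (x ∷ xs) infix⇒Q with does (P? x)
      ... | true  = rest-all xs (infix⇒Q ∘ there)
      ... | false = runs-all xs (infix⇒Q ∘ there)

module _ {a b p} {A : Set a} {B : Set b} {P : Pred B p} (P? : Decidable P) (f : A → B) where

  runs-map : ∀ xs → runs P? (map f xs) ≡ map (map f) (runs (P? ∘ f) xs)
  runs-map xs =
    trans (cong (uncurry _∷?_) (spanRuns-map xs)) (sym (uncurry map-∷? (spanRuns (P? ∘ f) xs)))
    where
    map-∷? : ∀ ys yss → map (map f) (ys ∷? yss) ≡ map f ys ∷? map (map f) yss
    map-∷? []       yss = refl
    map-∷? (y ∷ ys) yss = refl
    spanRuns-map : ∀ xs →
                   spanRuns P? (map f xs) ≡ Product.map (map f) (map (map f)) (spanRuns (P? ∘ f) xs)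
    spanRuns-map []       = refl
    spanRuns-map (x ∷ xs) with does (P? (f x))
    ... | true  = cong (Product.map₁ (f x ∷_)) (spanRuns-map xs)
    ... | false = cong ([] ,_) (runs-map xs)

  filter-map : ∀ xs → filter P? (map f xs) ≡ map f (filter (P? ∘ f) xs)
  filter-map []       = refl
  filter-map (x ∷ xs) with does (P? (f x))
  ... | true  = cong (f x ∷_) (filter-map xs)
  ... | false = filter-map xs

Unique-++⁻ : ∀ {a} {A : Set a} (xs : List A) {ys} → Unique (xs ++ ys) →
             Unique xs × Unique ys × Disjoint xs ys
Unique-++⁻ []       u        = [] , u , λ ()
Unique-++⁻ (x ∷ xs) (x∉ ∷ u) with uxs , uys , disj ← Unique-++⁻ xs u =
  Allₚ.++⁻ˡ xs x∉ ∷ uxs , uys , λ where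
    (here refl , v∈ys) → All.lookup (Allₚ.++⁻ʳ xs x∉) v∈ys refl
    (there v∈xs , v∈ys) → disj (v∈xs , v∈ys)

module _ {a} {A : Set a} where

  lists≤ : ℕ → List A → List (List A)
  lists≤ zero    xs = [] ∷ []
  lists≤ (suc k) xs = [] ∷ cartesianProductWith _∷_ xs (lists≤ k xs)

  ∈-lists≤ : ∀ {k xs ys} → All (_∈ xs) ys → length ys ≤ k → ys ∈ lists≤ k xs
  ∈-lists≤ {zero}  []         _        = here refl
  ∈-lists≤ {suc k} []         _        = here refl
  ∈-lists≤ {suc k} (y∈ ∷ ys∈) (s≤s le) = there (∈-cartesianProductWith⁺ _∷_ y∈ (∈-lists≤ ys∈ le))

  unique-↭ : ∀ {xs ys : List A} → Unique xs → Unique ys → (∀ {v} → v ∈ xs ⇔ v ∈ ys) → xs ↭ ys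
  unique-↭ uxs uys same = ∼bag⇒↭ (unique∧set⇒bag uxs uys same)

  Unique-resp-↭ : ∀ {xs ys : List A} → xs ↭ ys → Unique xs → Unique ys
  Unique-resp-↭ p = Permₛ.Unique-resp-↭ (setoid A) (↭⇒↭ₛ p)

module _ {a p} {X : Set a} {P : Pred X p} (P? : Decidable P) (f : X → ℕ) where

  minimiser : ∀ {x₀} xs → P x₀ → (∀ {x} → P x → x ∈ xs) →
              ∃ λ m → P m × (∀ {y} → P y → f m ≤ f y)
  minimiser {x₀} xs px₀ complete =
    argmin f x₀ (filter P? xs) ,
    argmin-all f px₀ (Allₚ.all-filter P? xs) ,
    λ py → All.lookup (f[argmin]≤f[xs] x₀ (filter P? xs)) (∈-filter⁺ P? (complete py) py)

module _ {n : ℕ} where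

  ↭-allFin⇔ : ∀ {xs} → (Unique xs × ∀ v → v ∈ xs) ⇔ (xs ↭ allFin n)
  ↭-allFin⇔ = mk⇔
    (λ (u , complete) →
      unique-↭ u (Uniqueₚ.allFin⁺ n) λ {v} → mk⇔ (λ _ → ∈-allFin v) (λ _ → complete v))
    (λ p → Unique-resp-↭ (↭-sym p) (Uniqueₚ.allFin⁺ n) , λ v → ∈-resp-↭ (↭-sym p) (∈-allFin v))

  ↭-allFin? : Decidable (_↭ allFin n)
  ↭-allFin? xs = Dec.map ↭-allFin⇔ (unique? _≟_ xs ×-dec Fin.all? (λ v → _∈?_ _≟_ v xs))

  ∀-lists? : ∀ {q} {Q : Pred (List (Fin n)) q} k → Decidable Q → (∀ ys → k ≤ length ys → Q ys) →
             Dec (∀ ys → Q ys)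
  ∀-lists? {Q = Q} k Q? long =
    map′ from (λ h → All.tabulate λ {ys} _ → h ys) (all? Q? (lists≤ k (allFin n)))
    where
    from : All Q (lists≤ k (allFin n)) → ∀ ys → Q ys
    from short ys with k ≤? length ys
    ... | yes k≤ = long ys k≤
    ... | no  k≰ = All.lookup short (∈-lists≤ (All.tabulate λ {v} _ → ∈-allFin v) (<⇒≤ (≰⇒> k≰)))

-- Kind sequences

data Kind : Set where
  hub pendant inner outer : Kind

_≟ₖ_ : DecidableEquality Kind
hub     ≟ₖ hub     = yes refl
pendant ≟ₖ pendant = yes refl
inner   ≟ₖ inner   = yes refl
outer   ≟ₖ outer   = yes refl
hub     ≟ₖ pendant = no λ ()
hub     ≟ₖ inner   = no λ ()
hub     ≟ₖ outer   = no λ ()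
pendant ≟ₖ hub     = no λ ()
pendant ≟ₖ inner   = no λ ()
pendant ≟ₖ outer   = no λ ()
inner   ≟ₖ hub     = no λ ()
inner   ≟ₖ pendant = no λ ()
inner   ≟ₖ outer   = no λ ()
outer   ≟ₖ hub     = no λ ()
outer   ≟ₖ pendant = no λ ()
outer   ≟ₖ inner   = no λ ()

data Compatible : Kind → Kind → Set where
  hub-any     : ∀ {k} → Compatible hub k
  any-hub     : ∀ {k} → Compatible k hub
  inner-inner : Compatible inner inner
  outer-outer : Compatible outer outer

count : Kind → List Kind → ℕ
count k ks = length (filter (_≟ₖ k) ks)

count-++ : ∀ k ks ls → count k (ks ++ ls) ≡ count k ks + count k ls
count-++ k ks ls = trans (cong length (filter-++ (_≟ₖ k) ks ls)) (length-++ (filter (_≟ₖ k) ks))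

count-∷ : ∀ k l ks → count k ks ≤ count k (l ∷ ks)
count-∷ k l ks with l ≟ₖ k
... | yes _ = n≤1+n _
... | no _  = ≤-refl

runCount : Kind → List Kind → ℕ
runCount k ks = length (runs (_≟ₖ k) ks)

-- On a compatible sequence, blocks counts the maximal hub-free segments (each a pendant or a
-- maximal inner or outer run); consecutive segments are separated by hubs.
blocks : List Kind → ℕ
blocks ks = count pendant ks + (runCount inner ks + runCount outer ks)

blocks-∷hub : ∀ k ks → blocks (k ∷ hub ∷ ks) ≤ suc (blocks ks)
blocks-∷hub hub     ks = n≤1+n _
blocks-∷hub pendant ks = ≤-refl
blocks-∷hub inner   ks = ≤-reflexive (+-suc _ _)
blocks-∷hub outer   ks = ≤-reflexive (trans (cong (count pendant ks +_) (+-suc _ _)) (+-suc _ _))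

blocks-bound : ∀ {ks} → Linked Compatible ks → blocks ks ≤ suc (count hub ks)
blocks-bound []                 = z≤n
blocks-bound {hub ∷ []}     [-] = z≤n
blocks-bound {pendant ∷ []} [-] = ≤-refl
blocks-bound {inner ∷ []}   [-] = ≤-refl
blocks-bound {outer ∷ []}   [-] = ≤-refl
blocks-bound (hub-any ∷ c)      = m≤n⇒m≤1+n (blocks-bound c)
blocks-bound {k ∷ hub ∷ ks} (any-hub ∷ c) =
  ≤-trans (blocks-∷hub k ks) (s≤s (≤-trans (blocks-bound (Linked.tail c)) (count-∷ hub k (hub ∷ ks))))
blocks-bound (inner-inner ∷ c)  = blocks-bound c
blocks-bound (outer-outer ∷ c)  = blocks-bound c

module _ {a} {A : Set a} (kind : A → Kind) where

  isOuter? : Decidable (λ x → kind x ≡ outer)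
  isOuter? x = kind x ≟ₖ outer

  outerRuns : List (List A) → List (List A)
  outerRuns qs = concat (map (runs isOuter?) qs)

  innerRunCount : List (List A) → ℕ
  innerRunCount qs = sum (map (runCount inner ∘ map kind) qs)

  concat-outerRuns : ∀ qs → concat (outerRuns qs) ≡ filter isOuter? (concat qs)
  concat-outerRuns []       = refl
  concat-outerRuns (q ∷ qs) = begin
      concat (runs isOuter? q ++ outerRuns qs)
    ≡⟨ concat-++ (runs isOuter? q) _ ⟨
      concat (runs isOuter? q) ++ concat (outerRuns qs)
    ≡⟨ cong₂ _++_ (concat-runs isOuter? q) (concat-outerRuns qs) ⟩
      filter isOuter? q ++ filter isOuter? (concat qs)
    ≡⟨ filter-++ isOuter? q (concat qs) ⟨
      filter isOuter? (q ++ concat qs)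
    ∎
    where open ≡-Reasoning

  length-runs-outer : ∀ q → length (runs isOuter? q) ≡ runCount outer (map kind q)
  length-runs-outer q =
    trans (sym (length-map (map kind) (runs isOuter? q))) (cong length (sym (runs-map (_≟ₖ outer) kind q)))

  count-map : ∀ k xs → count k (map kind xs) ≡ length (filter (λ x → kind x ≟ₖ k) xs)
  count-map k xs =
    trans (cong length (filter-map (_≟ₖ k) kind xs)) (length-map kind (filter (λ x → kind x ≟ₖ k) xs))

  innerRunCount-pos : ∀ {x q qs} → x ∈ q → q ∈ qs → kind x ≡ inner → 1 ≤ innerRunCount qs
  innerRunCount-pos x∈q (here refl) x-inner =
    ≤-trans (runs-nonempty (_≟ₖ inner) (Anyₚ.map⁺ (Any.map (λ { refl → x-inner }) x∈q))) (m≤m+n _ _)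
  innerRunCount-pos x∈q (there q∈qs) x-inner = ≤-trans (innerRunCount-pos x∈q q∈qs x-inner) (m≤n+m _ _)

  blocks-sum : ∀ {qs} → All (Linked Compatible ∘ map kind) qs →
               count pendant (map kind (concat qs)) + (innerRunCount qs + length (outerRuns qs))
                 ≤ count hub (map kind (concat qs)) + length qs
  blocks-sum []                 = z≤n
  blocks-sum {q ∷ qs} (c ∷ cs) = begin
      count pendant (map kind (q ++ concat qs)) + ((i + I) + length (runs isOuter? q ++ outerRuns qs))
    ≡⟨ cong₂ (λ x y → x + ((i + I) + y)) (count-map-++ pendant)
             (trans (length-++ (runs isOuter? q)) (cong (_+ length (outerRuns qs)) (length-runs-outer q))) ⟩
      (p + P) + ((i + I) + (o + O))
    ≡⟨ shuffle p P i I o O ⟩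
      blocks (map kind q) + (P + (I + O))
    ≤⟨ +-mono-≤ (blocks-bound c) (blocks-sum cs) ⟩
      suc h + (H + length qs)
    ≡⟨ shuffle′ h H (length qs) ⟩
      (h + H) + suc (length qs)
    ≡⟨ cong (_+ suc (length qs)) (count-map-++ hub) ⟨
      count hub (map kind (q ++ concat qs)) + suc (length qs)
    ∎
    where
    open ≤-Reasoning
    p P h H i I o O : ℕ
    p = count pendant (map kind q)
    P = count pendant (map kind (concat qs))
    h = count hub (map kind q)
    H = count hub (map kind (concat qs))
    i = runCount inner (map kind q)
    I = innerRunCount qs
    o = runCount outer (map kind q)
    O = length (outerRuns qs)
    count-map-++ : ∀ k → count k (map kind (q ++ concat qs)) ≡ count k (map kind q) + count k (map kind (concat qs))
    count-map-++ k =
      trans (cong (count k) (map-++ kind q (concat qs))) (count-++ k (map kind q) (map kind (concat qs)))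
    shuffle : ∀ p P i I o O → (p + P) + ((i + I) + (o + O)) ≡ (p + (i + o)) + (P + (I + O))
    shuffle = solve-∀
    shuffle′ : ∀ h H L → suc h + (H + L) ≡ (h + H) + suc L
    shuffle′ = solve-∀

module _ {n : ℕ} (kind : Fin n → Kind) where

  count-enumeration : ∀ {xs ys k} → xs ↭ allFin n → Unique ys → (∀ {v} → kind v ≡ k ⇔ v ∈ ys) →
                      count k (map kind xs) ≡ length ys
  count-enumeration {xs} {ys} {k} xs↭ uys kind⇔ =
    trans (count-map kind k xs) (↭-length (unique-↭ ufxs uys same))
    where
    P? : Decidable (λ v → kind v ≡ k)
    P? v = kind v ≟ₖ k
    ufxs : Unique (filter P? xs)
    ufxs = Uniqueₚ.filter⁺ P? (proj₁ (Equivalence.from ↭-allFin⇔ xs↭))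
    same : ∀ {v} → v ∈ filter P? xs ⇔ v ∈ ys
    same {v} = mk⇔ (Equivalence.to kind⇔ ∘ proj₂ ∘ ∈-filter⁻ P? {xs = xs})
                   λ v∈ys → ∈-filter⁺ P? (proj₂ (Equivalence.from ↭-allFin⇔ xs↭) v) (Equivalence.from kind⇔ v∈ys)

-- Walks, isometric paths and cherries

endpoint-++ : ∀ {A : Set} (x : A) ys zs → endpoint x (ys ++ zs) ≡ endpoint (endpoint x ys) zs
endpoint-++ x []       zs = refl
endpoint-++ x (y ∷ ys) zs = endpoint-++ y ys zs

split-internal : ∀ {A : Set} (x : A) w → endpoint x w ≢ x →
                 x ∷ w ≡ x ∷ internal (x ∷ w) ++ endpoint x w ∷ []
split-internal x []      ends≢ = contradiction refl ends≢
split-internal x (y ∷ w) _     = cong (x ∷_) (dropLast-snoc y w)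
  where
  dropLast-snoc : ∀ y w → y ∷ w ≡ dropLast (y ∷ w) ++ endpoint y w ∷ []
  dropLast-snoc y []      = refl
  dropLast-snoc y (z ∷ w) = cong (y ∷_) (dropLast-snoc z w)

module _ {r} {A : Set} {R : Rel A r} where

  linked-++⁻ : ∀ x ys {zs} → Linked R (x ∷ ys ++ zs) →
               Linked R (x ∷ ys) × Linked R (endpoint x ys ∷ zs)
  linked-++⁻ x []       l       = [-] , l
  linked-++⁻ x (y ∷ ys) (r ∷ l) with l₁ , l₂ ← linked-++⁻ y ys l = r ∷ l₁ , l₂

  linked-++⁺ : ∀ x ys {zs} → Linked R (x ∷ ys) → Linked R (endpoint x ys ∷ zs) →
               Linked R (x ∷ ys ++ zs)
  linked-++⁺ x []       _       l₂ = l₂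
  linked-++⁺ x (y ∷ ys) (r ∷ l₁) l₂ = r ∷ linked-++⁺ y ys l₁ l₂

module _ {n : ℕ} (G : Graph n) where

  isIsoPath-[_] : ∀ x → IsIsoPath G (x ∷ [])
  isIsoPath-[ x ] = [] ∷ [] , [-] , λ _ _ _ → z≤n

  isIsoPath-tail : ∀ {x y ys} → IsIsoPath G (x ∷ y ∷ ys) → IsIsoPath G (y ∷ ys)
  isIsoPath-tail {y = y} (_ ∷ u , e ∷ l , shortest) =
    u , l , λ w walk end → ≤-pred (shortest (y ∷ w) (e ∷ walk) end)

  isIsoPath-++⁻ˡ : ∀ {x} ys {zs} → IsIsoPath G (x ∷ ys ++ zs) → IsIsoPath G (x ∷ ys)
  isIsoPath-++⁻ˡ {x} ys {zs} (u , l , shortest) =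
    proj₁ (Unique-++⁻ (x ∷ ys) u) , proj₁ (linked-++⁻ x ys l) , shortest′
    where
    shortest′ : ∀ w → Walk G x w → endpoint x w ≡ endpoint x ys → length ys ≤ length w
    shortest′ w walk end = +-cancelʳ-≤ (length zs) (length ys) (length w)
      (subst₂ _≤_ (length-++ ys) (length-++ w) (shortest (w ++ zs) walk′ end′))
      where
      walk′ : Walk G x (w ++ zs)
      walk′ = linked-++⁺ x w walk
                (subst (λ v → Linked (Adj G) (v ∷ zs)) (sym end) (proj₂ (linked-++⁻ x ys l)))
      end′ : endpoint x (w ++ zs) ≡ endpoint x (ys ++ zs)
      end′ = begin
        endpoint x (w ++ zs)           ≡⟨ endpoint-++ x w zs ⟩
        endpoint (endpoint x w) zs     ≡⟨ cong (λ v → endpoint v zs) end ⟩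
        endpoint (endpoint x ys) zs    ≡⟨ endpoint-++ x ys zs ⟨
        endpoint x (ys ++ zs)          ∎
        where open ≡-Reasoning

  isIsoPath-infix : ∀ {y ys xs} → Infix _≡_ (y ∷ ys) xs → IsIsoPath G xs → IsIsoPath G (y ∷ ys)
  isIsoPath-infix {ys = ys} (here p) iso with Prefix.toView p
  ... | pw Prefix.++ _ with refl ← Pointwise-≡⇒≡ pw = isIsoPath-++⁻ˡ ys iso
  isIsoPath-infix {xs = _ ∷ _ ∷ _} (there inf) iso = isIsoPath-infix inf (isIsoPath-tail iso)
  isIsoPath-infix {xs = _ ∷ []} (there (here ()))

  adj-sym : ∀ {x y} → Adj G x y → Adj G y x
  adj-sym {x} {y} = subst T (Graph.sym G x y)

  adj⇒≢ : ∀ {x y} → Adj G x y → x ≢ y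
  adj⇒≢ {x} e refl = subst T (irrefl G x) e

  leaf-adj-unique : ∀ {x y z} → degree G x ≡ 1 → Adj G x y → Adj G x z → y ≡ z
  leaf-adj-unique {x} {y} {z} deg e e′ =
    singleton-∈ deg (∈-filter⁺ (T? ∘ adj G x) (∈-allFin y) e) (∈-filter⁺ (T? ∘ adj G x) (∈-allFin z) e′)
    where
    singleton-∈ : ∀ {vs : List (Fin n)} → length vs ≡ 1 → y ∈ vs → z ∈ vs → y ≡ z
    singleton-∈ {_ ∷ []} _ (here refl) (here refl) = refl

  Branching : Fin n → Set
  Branching v = ∃₂ λ y z → Adj G v y × Adj G v z × y ≢ z

  internal-branching : ∀ {x w v} → Walk G x w → Unique (x ∷ w) → v ∈ internal (x ∷ w) → Branching v
  internal-branching {x} {_ ∷ z ∷ _} (e ∷ e′ ∷ _) (x∉ ∷ _) (here refl) =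
    x , z , adj-sym e , e′ , All.lookup x∉ (there (here refl))
  internal-branching {w = _ ∷ _ ∷ _} (_ ∷ walk) (_ ∷ u) (there v∈) = internal-branching walk u v∈

  module _ {x m y : Fin n} where

    cherry-leaf-adj : Cherry G x m y → ∀ {v} → v ∈ x ∷ y ∷ [] → Adj G v m
    cherry-leaf-adj (xm , _)      (here refl)         = xm
    cherry-leaf-adj (_ , my , _)  (there (here refl)) = adj-sym my

    cherry-leaf-adj-unique : Cherry G x m y → ∀ {v z} → v ∈ x ∷ y ∷ [] → Adj G v z → z ≡ m
    cherry-leaf-adj-unique (xm , _ , _ , _ , deg-x , _) (here refl) e = leaf-adj-unique deg-x e xm
    cherry-leaf-adj-unique (_ , my , _ , _ , _ , deg-y) (there (here refl)) e =
      leaf-adj-unique deg-y e (adj-sym my)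

    cherry-leaf-¬branching : Cherry G x m y → ∀ {v} → v ∈ x ∷ y ∷ [] → ¬ Branching v
    cherry-leaf-¬branching cherry v∈ (_ , _ , e , e′ , y≢z) =
      y≢z (trans (cherry-leaf-adj-unique cherry v∈ e) (sym (cherry-leaf-adj-unique cherry v∈ e′)))

    cherry-middle-branching : Cherry G x m y → Branching m
    cherry-middle-branching (xm , my , x≢y , _) = x , y , adj-sym xm , my , x≢y

    cherry-leaves-unique : Cherry G x m y → Unique (x ∷ y ∷ [])
    cherry-leaves-unique (_ , _ , x≢y , _) = (x≢y ∷ []) ∷ [] ∷ []

    cherry-isIsoPath : Cherry G x m y → IsIsoPath G (x ∷ m ∷ y ∷ [])
    cherry-isIsoPath (xm , my , x≢y , ¬xy , _) =
      ((adj⇒≢ xm ∷ x≢y ∷ []) ∷ (adj⇒≢ my ∷ []) ∷ [] ∷ []) , xm ∷ my ∷ [-] , shortest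
      where
      shortest : ∀ w → Walk G x w → endpoint x w ≡ y → 2 ≤ length w
      shortest []          _       x≡y  = contradiction x≡y x≢y
      shortest (_ ∷ [])    (e ∷ _) refl = contradiction e ¬xy
      shortest (_ ∷ _ ∷ _) _       _    = s≤s (s≤s z≤n)

-- Minimum IP-partitions

module _ {n : ℕ} (G : Graph n) where

  isIsoPath? : Decidable (IsIsoPath G)
  isIsoPath? []      = no λ ()
  isIsoPath? (x ∷ w) = unique? _≟_ (x ∷ w) ×-dec walk? w ×-dec
    ∀-lists? (length w)
      (λ w′ → walk? w′ →-dec (endpoint x w′ ≟ endpoint x w →-dec length w ≤? length w′))
      (λ _ long _ _ → long)
    where
    walk? : Decidable (Walk G x)
    walk? w′ = linked? (λ u v → T? (adj G u v)) (x ∷ w′)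

  ipPartition? : Decidable (IPPartition G)
  ipPartition? ps = all? isIsoPath? ps ×-dec ↭-allFin? (concat ps)

  ipPartition-bounded : ∀ {ps} → IPPartition G ps → ps ∈ lists≤ n (lists≤ n (allFin n))
  ipPartition-bounded {ps} (paths , p) =
    ∈-lists≤ (All.tabulate λ q∈ →
               ∈-lists≤ (All.tabulate λ {v} _ → ∈-allFin v) (≤-trans (∈⇒length≤length-concat q∈) ≤n))
             (≤-trans (paths⇒length≤length-concat paths) ≤n)
    where
    ≤n : length (concat ps) ≤ n
    ≤n = ≤-reflexive (trans (↭-length p) (length-tabulate _))
    ∈⇒length≤length-concat : ∀ {q qs} → q ∈ qs → length q ≤ length (concat qs)
    ∈⇒length≤length-concat {q} (here refl) = length-++-≤ˡ q
    ∈⇒length≤length-concat {qs = q′ ∷ _} (there q∈) =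
      ≤-trans (∈⇒length≤length-concat q∈) (length-++-≤ʳ _ {q′})
    paths⇒length≤length-concat : ∀ {qs} → All (IsIsoPath G) qs → length qs ≤ length (concat qs)
    paths⇒length≤length-concat {[]} [] = z≤n
    paths⇒length≤length-concat {(_ ∷ w) ∷ qs} (_ ∷ paths) =
      s≤s (≤-trans (paths⇒length≤length-concat paths) (length-++-≤ʳ _ {w}))

  singletons-ipPartition : IPPartition G (map [_] (allFin n))
  singletons-ipPartition =
    Allₚ.map⁺ (All.tabulate λ {x} _ → isIsoPath-[_] G x) , ↭-reflexive (concat-map-[ allFin n ])

  minIPPartition : ∃ (MinIPPartition G)
  minIPPartition
    with m , ipp , least ← minimiser ipPartition? length _ singletons-ipPartition ipPartition-bounded =
    m , ipp , λ qs → least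

-- Two cherries joined by an isometric path

module CherryPair {n : ℕ} (G : Graph n) {u₁ a u₂ u₃ b u₄ : Fin n} {w : List (Fin n)}
  (cherry₁ : Cherry G u₁ a u₂) (cherry₂ : Cherry G u₃ b u₄) (a≢b : a ≢ b)
  (w-ends : endpoint a w ≡ b) (P-iso : IsIsoPath G (a ∷ w))
  (attached : ∀ v → v ∉ u₁ ∷ a ∷ u₂ ∷ u₃ ∷ b ∷ u₄ ∷ a ∷ w →
                ∀ x → Adj G v x → x ∈ u₁ ∷ a ∷ u₂ ∷ u₃ ∷ b ∷ u₄ ∷ a ∷ w → x ≡ a ⊎ x ≡ b)
  where

  I hubs pendants cherryVertices core : List (Fin n)
  I              = internal (a ∷ w)
  hubs           = a ∷ b ∷ []
  pendants       = (u₁ ∷ u₂ ∷ []) ++ (u₃ ∷ u₄ ∷ [])   -- grouped by cherry, for ∈-++⁻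
  cherryVertices = u₁ ∷ a ∷ u₂ ∷ u₃ ∷ b ∷ u₄ ∷ []
  core           = cherryVertices ++ I

  P-split : a ∷ w ≡ a ∷ I ++ b ∷ []
  P-split = subst (λ v → a ∷ w ≡ a ∷ I ++ v ∷ []) w-ends
                  (split-internal a w λ ends≡a → a≢b (trans (sym ends≡a) w-ends))

  P-unique : Unique (a ∷ I ++ b ∷ [])
  P-unique = subst Unique P-split (proj₁ P-iso)

  I-unique : Unique I
  I-unique with _ ∷ u ← P-unique = proj₁ (Unique-++⁻ I u)

  hubs∩I : Disjoint hubs I
  hubs∩I (here refl         , v∈I) with a∉ ∷ _ ← P-unique = All.lookup a∉ (∈-++⁺ˡ v∈I) refl
  hubs∩I (there (here refl) , v∈I) with _ ∷ u ← P-unique =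
    proj₂ (proj₂ (Unique-++⁻ I u)) (v∈I , here refl)

  I-isIsoPath : ∀ {y ys} → I ≡ y ∷ ys → IsIsoPath G (y ∷ ys)
  I-isIsoPath {ys = ys} I≡ =
    isIsoPath-++⁻ˡ G ys (isIsoPath-tail G
      (subst (IsIsoPath G) (trans P-split (cong (λ J → a ∷ J ++ b ∷ []) I≡)) P-iso))

  I⊆P : ∀ {v} → v ∈ I → v ∈ a ∷ w
  I⊆P {v} v∈I = subst (v ∈_) (sym P-split) (there (∈-++⁺ˡ v∈I))

  pendant-adj : ∀ {v x} → v ∈ pendants → Adj G v x → x ∈ hubs
  pendant-adj v∈ e with ∈-++⁻ (u₁ ∷ u₂ ∷ []) v∈
  ... | inj₁ v∈₁ = here (cherry-leaf-adj-unique G cherry₁ v∈₁ e)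
  ... | inj₂ v∈₂ = there (here (cherry-leaf-adj-unique G cherry₂ v∈₂ e))

  pendant-¬branching : ∀ {v} → v ∈ pendants → ¬ Branching G v
  pendant-¬branching v∈ with ∈-++⁻ (u₁ ∷ u₂ ∷ []) v∈
  ... | inj₁ v∈₁ = cherry-leaf-¬branching G cherry₁ v∈₁
  ... | inj₂ v∈₂ = cherry-leaf-¬branching G cherry₂ v∈₂

  hub-branching : ∀ {v} → v ∈ hubs → Branching G v
  hub-branching (here refl)         = cherry-middle-branching G cherry₁
  hub-branching (there (here refl)) = cherry-middle-branching G cherry₂

  hubs∩pendants : Disjoint hubs pendants
  hubs∩pendants (h , p) = pendant-¬branching p (hub-branching h)

  pendants∩I : Disjoint pendants I
  pendants∩I (p , i) =
    pendant-¬branching p (internal-branching G (proj₁ (proj₂ P-iso)) (proj₁ P-iso) i)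

  pendants-unique : Unique pendants
  pendants-unique = Uniqueₚ.++⁺ (cherry-leaves-unique G cherry₁) (cherry-leaves-unique G cherry₂)
    λ (v∈₁ , v∈₂) → a≢b (sym (cherry-leaf-adj-unique G cherry₁ v∈₁ (cherry-leaf-adj G cherry₂ v∈₂)))

  core-↭ : core ↭ hubs ++ pendants ++ I
  core-↭ = ↭-trans (↭-swap u₁ a ↭-refl) (↭-prep a (shift b (u₁ ∷ u₂ ∷ u₃ ∷ []) (u₄ ∷ I)))

  core-unique : Unique core
  core-unique = Unique-resp-↭ (↭-sym core-↭)
    (Uniqueₚ.++⁺ ((a≢b ∷ []) ∷ [] ∷ []) (Uniqueₚ.++⁺ pendants-unique I-unique pendants∩I)
      λ (h , v∈) → Sum.[ (λ p → hubs∩pendants (h , p)) , (λ i → hubs∩I (h , i)) ] (∈-++⁻ pendants v∈))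

  data Class (v : Fin n) : Kind → Set where
    hub     : v ∈ hubs     → Class v hub
    pendant : v ∈ pendants → Class v pendant
    inner   : v ∈ I        → Class v inner
    outer   : v ∉ core     → Class v outer

  classify : ∀ v → ∃ (Class v)
  classify v with _∈?_ _≟_ v core
  ... | no v∉core = outer , outer v∉core
  ... | yes v∈core with ∈-++⁻ hubs (∈-resp-↭ core-↭ v∈core)
  ...   | inj₁ v∈hubs = hub , hub v∈hubs
  ...   | inj₂ v∈rest with ∈-++⁻ pendants v∈rest
  ...     | inj₁ v∈pendants = pendant , pendant v∈pendants
  ...     | inj₂ v∈I        = inner , inner v∈I

  kind : Fin n → Kind
  kind v = proj₁ (classify v)

  class-member : ∀ {v k} → Class v k → k ≢ outer → v ∈ core
  class-member (hub h)     _ = ∈-resp-↭ (↭-sym core-↭) (∈-++⁺ˡ h)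
  class-member (pendant p) _ = ∈-resp-↭ (↭-sym core-↭) (∈-++⁺ʳ hubs (∈-++⁺ˡ p))
  class-member (inner i)   _ = ∈-resp-↭ (↭-sym core-↭) (∈-++⁺ʳ hubs (∈-++⁺ʳ pendants i))
  class-member (outer _)   k≢outer = contradiction refl k≢outer

  class-unique : ∀ {v k l} → Class v k → Class v l → k ≡ l
  class-unique (hub _)     (hub _)     = refl
  class-unique (pendant _) (pendant _) = refl
  class-unique (inner _)   (inner _)   = refl
  class-unique (outer _)   (outer _)   = refl
  class-unique (hub h)     (pendant p) = contradiction (h , p) hubs∩pendants
  class-unique (hub h)     (inner i)   = contradiction (h , i) hubs∩I
  class-unique (pendant p) (hub h)     = contradiction (h , p) hubs∩pendants
  class-unique (pendant p) (inner i)   = contradiction (p , i) pendants∩I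
  class-unique (inner i)   (hub h)     = contradiction (h , i) hubs∩I
  class-unique (inner i)   (pendant p) = contradiction (p , i) pendants∩I
  class-unique (hub h)     (outer o)   = contradiction (class-member (hub h) λ ()) o
  class-unique (pendant p) (outer o)   = contradiction (class-member (pendant p) λ ()) o
  class-unique (inner i)   (outer o)   = contradiction (class-member (inner i) λ ()) o
  class-unique (outer o)   (hub h)     = contradiction (class-member (hub h) λ ()) o
  class-unique (outer o)   (pendant p) = contradiction (class-member (pendant p) λ ()) o
  class-unique (outer o)   (inner i)   = contradiction (class-member (inner i) λ ()) o

  class-of : ∀ v → Class v (kind v)
  class-of v = proj₂ (classify v)

  kind-≡ : ∀ {v k} → Class v k → kind v ≡ k
  kind-≡ = class-unique (class-of _)

  kind≡hub⇔ : ∀ {v} → kind v ≡ hub ⇔ v ∈ hubs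
  kind≡hub⇔ {v} = mk⇔ (λ eq → member (subst (Class v) eq (class-of v))) (kind-≡ ∘ hub)
    where
    member : Class v hub → v ∈ hubs
    member (hub h) = h

  kind≡pendant⇔ : ∀ {v} → kind v ≡ pendant ⇔ v ∈ pendants
  kind≡pendant⇔ {v} = mk⇔ (λ eq → member (subst (Class v) eq (class-of v))) (kind-≡ ∘ pendant)
    where
    member : Class v pendant → v ∈ pendants
    member (pendant p) = p

  kind≡outer⇒∉core : ∀ {v} → kind v ≡ outer → v ∉ core
  kind≡outer⇒∉core {v} eq = non-member (subst (Class v) eq (class-of v))
    where
    non-member : Class v outer → v ∉ core
    non-member (outer o) = o

  P⊆core : ∀ {v} → v ∈ a ∷ w → v ∈ core
  P⊆core {v} v∈P with subst (v ∈_) P-split v∈P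
  ... | here v≡a = there (here v≡a)
  ... | there v∈ with ∈-++⁻ I v∈
  ...   | inj₁ v∈I        = ∈-++⁺ʳ cherryVertices v∈I
  ...   | inj₂ (here v≡b) = there (there (there (there (here v≡b))))

  outer-inner-¬adj : ∀ {u v} → u ∉ core → v ∈ I → ¬ Adj G u v
  outer-inner-¬adj {u} {v} u∉core v∈I e =
    hubs∩I (hub-member (attached u u∉H v e (∈-++⁺ʳ cherryVertices (I⊆P v∈I))) , v∈I)
    where
    hub-member : v ≡ a ⊎ v ≡ b → v ∈ hubs
    hub-member (inj₁ v≡a) = here v≡a
    hub-member (inj₂ v≡b) = there (here v≡b)
    u∉H : u ∉ cherryVertices ++ a ∷ w
    u∉H u∈H = u∉core (Sum.[ ∈-++⁺ˡ , P⊆core ] (∈-++⁻ cherryVertices u∈H))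

  adj-compatible : ∀ {u v} → Adj G u v → Compatible (kind u) (kind v)
  adj-compatible {u} {v} e = compatible (class-of u) (class-of v)
    where
    compatible : ∀ {k l} → Class u k → Class v l → Compatible k l
    compatible (hub _)     _           = hub-any
    compatible _           (hub _)     = any-hub
    compatible (pendant p) c           =
      subst (Compatible pendant) (class-unique (hub (pendant-adj p e)) c) any-hub
    compatible c           (pendant p) =
      subst (λ k → Compatible k pendant) (class-unique (hub (pendant-adj p (adj-sym G e))) c) hub-any
    compatible (inner _)   (inner _)   = inner-inner
    compatible (outer _)   (outer _)   = outer-outer
    compatible (outer o)   (inner i)   = contradiction e (outer-inner-¬adj o i)
    compatible (inner i)   (outer o)   = contradiction (adj-sym G e) (outer-inner-¬adj o i)

  isIsoPath-compatible : ∀ {q} → IsIsoPath G q → Linked Compatible (map kind q)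
  isIsoPath-compatible {_ ∷ _} (_ , walk , _) = Linkedₚ.map⁺ (Linked.map adj-compatible walk)

  cherryPartition : List (List (Fin n)) → List (List (Fin n))
  cherryPartition qs = (u₁ ∷ a ∷ u₂ ∷ []) ∷ (u₃ ∷ b ∷ u₄ ∷ []) ∷ I ∷? outerRuns kind qs

  concat-cherryPartition : ∀ qs → concat (cherryPartition qs) ≡ core ++ filter (isOuter? kind) (concat qs)
  concat-cherryPartition qs = cong (cherryVertices ++_)
    (trans (concat-∷? I (outerRuns kind qs)) (cong (I ++_) (concat-outerRuns kind qs)))

  cherryPartition-ip : ∀ {qs} → IPPartition G qs → IPPartition G (cherryPartition qs)
  cherryPartition-ip {qs} (paths , qs↭) =
    cherry-isIsoPath G cherry₁ ∷ cherry-isIsoPath G cherry₂ ∷ All-∷?⁺ I-isIsoPath outerRuns-iso ,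
    subst (_↭ allFin n) (sym (concat-cherryPartition qs)) (Equivalence.to ↭-allFin⇔ (unique , complete))
    where
    enum : Unique (concat qs) × ∀ v → v ∈ concat qs
    enum = Equivalence.from ↭-allFin⇔ qs↭
    outerRuns-iso : All (IsIsoPath G) (outerRuns kind qs)
    outerRuns-iso = Allₚ.concat⁺ (Allₚ.map⁺ (All.map (λ {q} q-iso →
      runs-all (isOuter? kind) q (λ inf → isIsoPath-infix G inf q-iso)) paths))
    unique : Unique (core ++ filter (isOuter? kind) (concat qs))
    unique = Uniqueₚ.++⁺ core-unique (Uniqueₚ.filter⁺ (isOuter? kind) (proj₁ enum))
      λ (v∈core , v∈outer) →
        kind≡outer⇒∉core (proj₂ (∈-filter⁻ (isOuter? kind) {xs = concat qs} v∈outer)) v∈core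
    complete : ∀ v → v ∈ core ++ filter (isOuter? kind) (concat qs)
    complete v with isOuter? kind v
    ... | yes v-outer = ∈-++⁺ʳ core (∈-filter⁺ (isOuter? kind) (proj₂ enum v) v-outer)
    ... | no  v-not-outer = ∈-++⁺ˡ (class-member (class-of v) v-not-outer)

  cherryPartition-length : ∀ {qs} → IPPartition G qs → length (cherryPartition qs) ≤ length qs
  cherryPartition-length {qs} (paths , qs↭) = begin
      length (cherryPartition qs)
    ≡⟨ cong (2 +_) (length-∷? I (outerRuns kind qs)) ⟩
      2 + (length (I ∷? []) + length (outerRuns kind qs))
    ≤⟨ +-monoʳ-≤ 2 (+-monoˡ-≤ (length (outerRuns kind qs)) I-counted) ⟩
      2 + runs-total
    ≤⟨ ≤-pred (≤-pred blocks-counted) ⟩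
      length qs
    ∎
    where
    open ≤-Reasoning
    runs-total : ℕ
    runs-total = innerRunCount kind qs + length (outerRuns kind qs)
    blocks-counted : 4 + runs-total ≤ 2 + length qs
    blocks-counted = subst₂ (λ p h → p + runs-total ≤ h + length qs)
      (count-enumeration kind qs↭ pendants-unique kind≡pendant⇔)
      (count-enumeration kind qs↭ ((a≢b ∷ []) ∷ [] ∷ []) kind≡hub⇔)
      (blocks-sum kind (All.map isIsoPath-compatible paths))
    inner-counted : ∀ {i} → i ∈ I → 1 ≤ innerRunCount kind qs
    inner-counted {i} i∈I
      with q , i∈q , q∈qs ← ∈-concat⁻′ qs (proj₂ (Equivalence.from ↭-allFin⇔ qs↭) i) =
      innerRunCount-pos kind i∈q q∈qs (kind-≡ (inner i∈I))
    I-counted : length (I ∷? []) ≤ innerRunCount kind qs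
    I-counted = length-∷?-≤ I λ {y} I≡ → inner-counted (subst (y ∈_) (sym I≡) (here refl))

mainTheorem8 : ∀ {n : ℕ} (G : Graph n) (u₁ a u₂ u₃ b u₄ : Fin n) (P : List (Fin n)) →
    Cherry G u₁ a u₂ → Cherry G u₃ b u₄ → a ≢ b →
    IsoPathBetween G a b P →
    (∀ v → v ∉ (u₁ ∷ a ∷ u₂ ∷ u₃ ∷ b ∷ u₄ ∷ P) →
      ∀ w → Adj G v w → w ∈ (u₁ ∷ a ∷ u₂ ∷ u₃ ∷ b ∷ u₄ ∷ P) → w ≡ a ⊎ w ≡ b) →
    Σ (List (List (Fin n))) λ ps →
      MinIPPartition G ps
      × (u₁ ∷ a ∷ u₂ ∷ []) ∈ᵖ ps
      × (u₃ ∷ b ∷ u₄ ∷ []) ∈ᵖ ps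
      × (internal P ≢ [] → internal P ∈ᵖ ps)
mainTheorem8 G u₁ a u₂ u₃ b u₄ _ cherry₁ cherry₂ a≢b (w , refl , w-ends , P-iso) attached
  with qs , qs-ip , qs-minimal ← minIPPartition G =
  cherryPartition qs ,
  (cherryPartition-ip qs-ip ,
   λ qs′ qs′-ip → ≤-trans (cherryPartition-length qs-ip) (qs-minimal qs′ qs′-ip)) ,
  inj₁ (here refl) ,
  inj₁ (there (here refl)) ,
  λ I≢[] → inj₁ (there (there (∈-∷? (outerRuns kind qs) I≢[])))
  where
  open CherryPair G cherry₁ cherry₂ a≢b w-ends P-iso attached
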